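{- Let $Q_1,Q_2\in\{\exists,\forall\}$. Let $$F_0 = Q_1x_1.\,A$$ be a formula, and suppose: - $F_0\to F_2$ by rewriting the top-level subformula $Q_1x_1.\,A$, so that $F_2=A\{x_1\mapsto\varepsilon x_1.\,\neg^{Q_1}A\}$; - $F_0\to F_1$ by rewriting an occurrence of a subformula $Q_2x_2.\,B$ properly inside $A$ (i.e. inside $F_0$ but not the whole of $F_0$). Then there are formulas $F_3,F_4$ such that: 1. $F_1\to F_4$, $F_3\to F_4$, and $F_2 \rightrightarrows F_3$. 2. If the step $F_0\to F_1$ is a $\to_1$-step, then $F_3\to_1 F_4$ and $F_2\rightrightarrows_1 F_3$. 3. If the step $F_0\to F_2$ is a $\to_1$-step, then $F_1\to_1 F_4$. 4. If the step $F_0\to F_2$ is a $\to_0$-step, then $F_3=F_2$.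
   Context: Terms and formulas are those of first-order logic extended by Hilbert's $\varepsilon$-binder. The syntax has: - individual variables; - formula variables; - function and predicate symbols; - connectives; - for an individual variable $x$ and a formula $F$: the term $\varepsilon x.\,F$ and the formulas $\exists x.\,F$ and $\forall x.\,F$, each binding $x$. Formulas are identified modulo renaming of bound variables. Substitution $F\{x\mapsto t\}$ is capture-avoiding. For $Q\in\{\exists,\forall\}$, write $\neg^{\forall}$ for $\neg$ and $\neg^{\exists}$ for the empty string. The relation $F\to G$ holds iff $G$ is obtained from $F$ by replacing one occurrence of a subformula $Qx.\,A$ (called the redex) by $A\{x\mapsto\varepsilon x.\,\neg^Q A\}$. The occurrence may lie anywhere in $F$, including inside $\varepsilon$-terms and under binders. The step is a $\to_0$-step if the quantifier is vacuous, i.e. $x$ does not occur free in $A$; otherwise it is a $\to_1$-step. The parallel rewrite relation is defined by: $F\rightrightarrows G$ iff $G$ is obtained from $F$ by simultaneously replacing $n\ge 0$ pairwise non-overlapping (disjoint) occurrences of subformulas $Q_ix_i.\,A_i$ by $A_i\{x_i\mapsto\varepsilon x_i.\,\neg^{Q_i}A_i\}$. $\rightrightarrows_1$ is the same relation restricted to the case where every rewritten quantifier is non-vacuous, i.e. $x_i$ occurs free in $A_i$. -}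

module Defs where

-- First-order logic with Hilbert's ε-binder, in de Bruijn representation
-- (so formulas are automatically identified modulo renaming of bound
-- variables, and substitution is capture-avoiding by construction).

open import Data.Nat using (ℕ; zero; suc; _≡ᵇ_)
open import Data.Bool using (Bool; true; false; _∨_)
open import Data.List using (List; []; _∷_)
open import Data.Unit using (⊤)
open import Relation.Binary.PropositionalEquality using (_≡_)
open import Data.Product using (Σ)

data Quant : Set where
  ex all : Quant

data BinOp : Set where
  and or imp iff : BinOp

mutual
  data Term : Set where
    var : ℕ → Term
    fun : ℕ → List Term → Term
    eps : Form → Term                 -- ε x. F   (binds index 0 in F)

  data Form : Set where
    fvar  : ℕ → Form
    pred  : ℕ → List Term → Form
    top   : Form
    bot   : Form
    neg   : Form → Form
    bin   : BinOp → Form → Form → Form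
    quant : Quant → Form → Form       -- Q x. F   (binds index 0 in F)

ext : (ℕ → ℕ) → ℕ → ℕ
ext ρ zero    = zero
ext ρ (suc n) = suc (ρ n)

mutual
  renT : (ℕ → ℕ) → Term → Term
  renT ρ (var n)    = var (ρ n)
  renT ρ (fun f ts) = fun f (renTs ρ ts)
  renT ρ (eps A)    = eps (renF (ext ρ) A)

  renTs : (ℕ → ℕ) → List Term → List Term
  renTs ρ []       = []
  renTs ρ (t ∷ ts) = renT ρ t ∷ renTs ρ ts

  renF : (ℕ → ℕ) → Form → Form
  renF ρ (fvar X)    = fvar X
  renF ρ (pred p ts) = pred p (renTs ρ ts)
  renF ρ top         = top
  renF ρ bot         = bot
  renF ρ (neg A)     = neg (renF ρ A)
  renF ρ (bin o A B) = bin o (renF ρ A) (renF ρ B)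
  renF ρ (quant Q A) = quant Q (renF (ext ρ) A)

exts : (ℕ → Term) → ℕ → Term
exts σ zero    = var zero
exts σ (suc n) = renT suc (σ n)

mutual
  subT : (ℕ → Term) → Term → Term
  subT σ (var n)    = σ n
  subT σ (fun f ts) = fun f (subTs σ ts)
  subT σ (eps A)    = eps (subF (exts σ) A)

  subTs : (ℕ → Term) → List Term → List Term
  subTs σ []       = []
  subTs σ (t ∷ ts) = subT σ t ∷ subTs σ ts

  subF : (ℕ → Term) → Form → Form
  subF σ (fvar X)    = fvar X
  subF σ (pred p ts) = pred p (subTs σ ts)
  subF σ top         = top
  subF σ bot         = bot
  subF σ (neg A)     = neg (subF σ A)
  subF σ (bin o A B) = bin o (subF σ A) (subF σ B)
  subF σ (quant Q A) = quant Q (subF (exts σ) A)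

sub0σ : Term → ℕ → Term
sub0σ t zero    = t
sub0σ t (suc n) = var n

_[_] : Form → Term → Form
A [ t ] = subF (sub0σ t) A

mutual
  isFreeT : ℕ → Term → Bool
  isFreeT n (var m)    = n ≡ᵇ m
  isFreeT n (fun f ts) = isFreeTs n ts
  isFreeT n (eps A)    = isFreeF (suc n) A

  isFreeTs : ℕ → List Term → Bool
  isFreeTs n []       = false
  isFreeTs n (t ∷ ts) = isFreeT n t ∨ isFreeTs n ts

  isFreeF : ℕ → Form → Bool
  isFreeF n (fvar X)    = false
  isFreeF n (pred p ts) = isFreeTs n ts
  isFreeF n top         = false
  isFreeF n bot         = false
  isFreeF n (neg A)     = isFreeF n A
  isFreeF n (bin o A B) = isFreeF n A ∨ isFreeF n B
  isFreeF n (quant Q A) = isFreeF (suc n) A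

negQ : Quant → Form → Form
negQ ex  A = A
negQ all A = neg A

contract : Quant → Form → Form
contract Q A = A [ eps (negQ Q A) ]

-- Kind of a redex  Q x. A : true = non-vacuous (→₁), false = vacuous (→₀)
redexKind : Form → Bool
redexKind A = isFreeF zero A

-- One-step rewriting  F ⟶[ k ] G : one redex occurrence (anywhere, including
-- inside ε-terms and under binders) is contracted; k records its kind
-- (true: →₁-step, false: →₀-step).

infix 4 _⟶T[_]_ _⟶Ts[_]_ _⟶[_]_

mutual
  data _⟶T[_]_ : Term → Bool → Term → Set where
    funS : ∀ {f ts ts' k} → ts ⟶Ts[ k ] ts' → fun f ts ⟶T[ k ] fun f ts'
    epsS : ∀ {A A' k} → A ⟶[ k ] A' → eps A ⟶T[ k ] eps A'

  data _⟶Ts[_]_ : List Term → Bool → List Term → Set where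
    hereS  : ∀ {t t' ts k} → t ⟶T[ k ] t' → (t ∷ ts) ⟶Ts[ k ] (t' ∷ ts)
    thereS : ∀ {t ts ts' k} → ts ⟶Ts[ k ] ts' → (t ∷ ts) ⟶Ts[ k ] (t ∷ ts')

  data _⟶[_]_ : Form → Bool → Form → Set where
    redex  : ∀ {Q A} → quant Q A ⟶[ redexKind A ] contract Q A
    predS  : ∀ {p ts ts' k} → ts ⟶Ts[ k ] ts' → pred p ts ⟶[ k ] pred p ts'
    negS   : ∀ {A A' k} → A ⟶[ k ] A' → neg A ⟶[ k ] neg A'
    binL   : ∀ {o A A' B k} → A ⟶[ k ] A' → bin o A B ⟶[ k ] bin o A' B
    binR   : ∀ {o A B B' k} → B ⟶[ k ] B' → bin o A B ⟶[ k ] bin o A B'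
    quantS : ∀ {Q A A' k} → A ⟶[ k ] A' → quant Q A ⟶[ k ] quant Q A'

_⟶_ : Form → Form → Set
F ⟶ G = Σ Bool (λ k → F ⟶[ k ] G)

-- Parallel rewriting  F ⇉[ m ] G : simultaneous contraction of n ≥ 0 pairwise
-- disjoint redex occurrences.  Mode anyR gives ⇉, mode nonvacR gives ⇉₁
-- (every contracted redex is non-vacuous).

data Mode : Set where
  anyR nonvacR : Mode

Allowed : Mode → Bool → Set
Allowed anyR    k = ⊤
Allowed nonvacR k = k ≡ true

infix 4 _⇉T[_]_ _⇉Ts[_]_ _⇉[_]_

mutual
  data _⇉T[_]_ : Term → Mode → Term → Set where
    varP : ∀ {n m} → var n ⇉T[ m ] var n
    funP : ∀ {f ts ts' m} → ts ⇉Ts[ m ] ts' → fun f ts ⇉T[ m ] fun f ts'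
    epsP : ∀ {A A' m} → A ⇉[ m ] A' → eps A ⇉T[ m ] eps A'

  data _⇉Ts[_]_ : List Term → Mode → List Term → Set where
    []P  : ∀ {m} → [] ⇉Ts[ m ] []
    _∷P_ : ∀ {t t' ts ts' m} → t ⇉T[ m ] t' → ts ⇉Ts[ m ] ts' → (t ∷ ts) ⇉Ts[ m ] (t' ∷ ts')

  data _⇉[_]_ : Form → Mode → Form → Set where
    redexP : ∀ {Q A m} → Allowed m (redexKind A) → quant Q A ⇉[ m ] contract Q A
    fvarP  : ∀ {X m} → fvar X ⇉[ m ] fvar X
    predP  : ∀ {p ts ts' m} → ts ⇉Ts[ m ] ts' → pred p ts ⇉[ m ] pred p ts'
    topP   : ∀ {m} → top ⇉[ m ] top
    botP   : ∀ {m} → bot ⇉[ m ] bot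
    negP   : ∀ {A A' m} → A ⇉[ m ] A' → neg A ⇉[ m ] neg A'
    binP   : ∀ {o A A' B B' m} → A ⇉[ m ] A' → B ⇉[ m ] B' → bin o A B ⇉[ m ] bin o A' B'
    quantP : ∀ {Q A A' m} → A ⇉[ m ] A' → quant Q A ⇉[ m ] quant Q A'

module Submission where

-- With F₀ = Q x. A, F₁ = Q x. A' and e' = ε x. ¬^Q A', take F₄ = A'{x ↦ e'}
-- (contract the outer redex of F₁) and F₃ = A{x ↦ e'}.  Then F₃ → F₄ because
-- rewriting is stable under substitution, and F₂ = A{x ↦ ε x. ¬^Q A} ⇉ F₃
-- because the one step ε x. ¬^Q A → e' is performed in parallel at every
-- occurrence of x in A.  These occurrences are disjoint, and there are none
-- when the outer quantifier is vacuous, in which case F₃ = F₂.  Finally a step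
-- never loses free variables, so a non-vacuous outer redex stays non-vacuous.

open import Defs
open import Data.Nat using (ℕ; zero; suc; _≡ᵇ_)
open import Data.Nat.Properties using (≡ᵇ⇒≡; ≡⇒≡ᵇ)
open import Data.Bool using (Bool; true; false; T; _∨_)
open import Data.Bool.Properties using (T-∨; T-≡)
open import Data.List using (List; []; _∷_)
open import Data.Empty using (⊥-elim)
open import Data.Sum using (inj₁; inj₂)
open import Data.Unit using (tt)
open import Data.Product using (Σ; _×_; _,_)
open import Function using (_∘_)
open import Function.Bundles using (Equivalence)
open import Relation.Binary.PropositionalEquality
  using (_≡_; refl; sym; trans; cong; cong₂; subst; subst₂; module ≡-Reasoning)
open ≡-Reasoning

open Equivalence using (to; from)

exts-cong-free : ∀ {σ τ} A → (∀ m → T (isFreeF (suc m) A) → σ m ≡ τ m) →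
                 ∀ m → T (isFreeF m A) → exts σ m ≡ exts τ m
exts-cong-free A h zero    _ = refl
exts-cong-free A h (suc m) p = cong (renT suc) (h m p)

mutual
  subT-cong-free : ∀ {σ τ} t → (∀ m → T (isFreeT m t) → σ m ≡ τ m) → subT σ t ≡ subT τ t
  subT-cong-free (var n)    h = h n (≡⇒≡ᵇ n n refl)
  subT-cong-free (fun f ts) h = cong (fun f) (subTs-cong-free ts h)
  subT-cong-free (eps A)    h = cong eps (subF-cong-free A (exts-cong-free A h))

  subTs-cong-free : ∀ {σ τ} ts → (∀ m → T (isFreeTs m ts) → σ m ≡ τ m) → subTs σ ts ≡ subTs τ ts
  subTs-cong-free []       h = refl
  subTs-cong-free (t ∷ ts) h =
    cong₂ _∷_ (subT-cong-free t (λ m → h m ∘ from T-∨ ∘ inj₁))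
              (subTs-cong-free ts (λ m → h m ∘ from T-∨ ∘ inj₂))

  subF-cong-free : ∀ {σ τ} A → (∀ m → T (isFreeF m A) → σ m ≡ τ m) → subF σ A ≡ subF τ A
  subF-cong-free (fvar X)    h = refl
  subF-cong-free (pred p ts) h = cong (pred p) (subTs-cong-free ts h)
  subF-cong-free top         h = refl
  subF-cong-free bot         h = refl
  subF-cong-free (neg A)     h = cong neg (subF-cong-free A h)
  subF-cong-free (bin o A B) h =
    cong₂ (bin o) (subF-cong-free A (λ m → h m ∘ from T-∨ ∘ inj₁))
                  (subF-cong-free B (λ m → h m ∘ from T-∨ ∘ inj₂))
  subF-cong-free (quant Q A) h = cong (quant Q) (subF-cong-free A (exts-cong-free A h))

subF-cong : ∀ {σ τ} → (∀ m → σ m ≡ τ m) → ∀ A → subF σ A ≡ subF τ A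
subF-cong h A = subF-cong-free A (λ m _ → h m)

[]-vacuous : ∀ A t u → isFreeF zero A ≡ false → A [ t ] ≡ A [ u ]
[]-vacuous A t u vac = subF-cong-free A agree
  where
  agree : ∀ m → T (isFreeF m A) → sub0σ t m ≡ sub0σ u m
  agree zero    p = ⊥-elim (subst T vac p)
  agree (suc m) _ = refl

mutual
  renT-as-subT : ∀ ρ t → renT ρ t ≡ subT (var ∘ ρ) t
  renT-as-subT ρ (var n)    = refl
  renT-as-subT ρ (fun f ts) = cong (fun f) (renTs-as-subTs ρ ts)
  renT-as-subT ρ (eps A)    = cong eps (renF-as-subF-ext ρ A)

  renTs-as-subTs : ∀ ρ ts → renTs ρ ts ≡ subTs (var ∘ ρ) ts
  renTs-as-subTs ρ []       = refl
  renTs-as-subTs ρ (t ∷ ts) = cong₂ _∷_ (renT-as-subT ρ t) (renTs-as-subTs ρ ts)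

  renF-as-subF : ∀ ρ A → renF ρ A ≡ subF (var ∘ ρ) A
  renF-as-subF ρ (fvar X)    = refl
  renF-as-subF ρ (pred p ts) = cong (pred p) (renTs-as-subTs ρ ts)
  renF-as-subF ρ top         = refl
  renF-as-subF ρ bot         = refl
  renF-as-subF ρ (neg A)     = cong neg (renF-as-subF ρ A)
  renF-as-subF ρ (bin o A B) = cong₂ (bin o) (renF-as-subF ρ A) (renF-as-subF ρ B)
  renF-as-subF ρ (quant Q A) = cong (quant Q) (renF-as-subF-ext ρ A)

  renF-as-subF-ext : ∀ ρ A → renF (ext ρ) A ≡ subF (exts (var ∘ ρ)) A
  renF-as-subF-ext ρ A = trans (renF-as-subF (ext ρ) A) (subF-cong var-ext A)
    where var-ext : ∀ m → var (ext ρ m) ≡ exts (var ∘ ρ) m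
          var-ext zero    = refl
          var-ext (suc m) = refl

mutual
  subT-renT : ∀ σ ρ t → subT σ (renT ρ t) ≡ subT (σ ∘ ρ) t
  subT-renT σ ρ (var n)    = refl
  subT-renT σ ρ (fun f ts) = cong (fun f) (subTs-renTs σ ρ ts)
  subT-renT σ ρ (eps A)    = cong eps (subF-renF-ext σ ρ A)

  subTs-renTs : ∀ σ ρ ts → subTs σ (renTs ρ ts) ≡ subTs (σ ∘ ρ) ts
  subTs-renTs σ ρ []       = refl
  subTs-renTs σ ρ (t ∷ ts) = cong₂ _∷_ (subT-renT σ ρ t) (subTs-renTs σ ρ ts)

  subF-renF : ∀ σ ρ A → subF σ (renF ρ A) ≡ subF (σ ∘ ρ) A
  subF-renF σ ρ (fvar X)    = refl
  subF-renF σ ρ (pred p ts) = cong (pred p) (subTs-renTs σ ρ ts)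
  subF-renF σ ρ top         = refl
  subF-renF σ ρ bot         = refl
  subF-renF σ ρ (neg A)     = cong neg (subF-renF σ ρ A)
  subF-renF σ ρ (bin o A B) = cong₂ (bin o) (subF-renF σ ρ A) (subF-renF σ ρ B)
  subF-renF σ ρ (quant Q A) = cong (quant Q) (subF-renF-ext σ ρ A)

  subF-renF-ext : ∀ σ ρ A → subF (exts σ) (renF (ext ρ) A) ≡ subF (exts (σ ∘ ρ)) A
  subF-renF-ext σ ρ A = trans (subF-renF (exts σ) (ext ρ) A) (subF-cong exts-ext A)
    where exts-ext : ∀ m → exts σ (ext ρ m) ≡ exts (σ ∘ ρ) m
          exts-ext zero    = refl
          exts-ext (suc m) = refl

renT-renT : ∀ ρ ρ' t → renT ρ (renT ρ' t) ≡ renT (ρ ∘ ρ') t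
renT-renT ρ ρ' t = begin
  renT ρ (renT ρ' t)          ≡⟨ renT-as-subT ρ (renT ρ' t) ⟩
  subT (var ∘ ρ) (renT ρ' t)  ≡⟨ subT-renT (var ∘ ρ) ρ' t ⟩
  subT (var ∘ ρ ∘ ρ') t       ≡⟨ renT-as-subT (ρ ∘ ρ') t ⟨
  renT (ρ ∘ ρ') t             ∎

exts-renT : ∀ ρ σ m → renT (ext ρ) (exts σ m) ≡ exts (renT ρ ∘ σ) m
exts-renT ρ σ zero    = refl
exts-renT ρ σ (suc m) = trans (renT-renT (ext ρ) suc (σ m)) (sym (renT-renT suc ρ (σ m)))

mutual
  renT-subT : ∀ ρ σ t → renT ρ (subT σ t) ≡ subT (renT ρ ∘ σ) t
  renT-subT ρ σ (var n)    = refl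
  renT-subT ρ σ (fun f ts) = cong (fun f) (renTs-subTs ρ σ ts)
  renT-subT ρ σ (eps A)    = cong eps (renF-subF-ext ρ σ A)

  renTs-subTs : ∀ ρ σ ts → renTs ρ (subTs σ ts) ≡ subTs (renT ρ ∘ σ) ts
  renTs-subTs ρ σ []       = refl
  renTs-subTs ρ σ (t ∷ ts) = cong₂ _∷_ (renT-subT ρ σ t) (renTs-subTs ρ σ ts)

  renF-subF : ∀ ρ σ A → renF ρ (subF σ A) ≡ subF (renT ρ ∘ σ) A
  renF-subF ρ σ (fvar X)    = refl
  renF-subF ρ σ (pred p ts) = cong (pred p) (renTs-subTs ρ σ ts)
  renF-subF ρ σ top         = refl
  renF-subF ρ σ bot         = refl
  renF-subF ρ σ (neg A)     = cong neg (renF-subF ρ σ A)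
  renF-subF ρ σ (bin o A B) = cong₂ (bin o) (renF-subF ρ σ A) (renF-subF ρ σ B)
  renF-subF ρ σ (quant Q A) = cong (quant Q) (renF-subF-ext ρ σ A)

  renF-subF-ext : ∀ ρ σ A → renF (ext ρ) (subF (exts σ) A) ≡ subF (exts (renT ρ ∘ σ)) A
  renF-subF-ext ρ σ A = trans (renF-subF (ext ρ) (exts σ) A) (subF-cong (exts-renT ρ σ) A)

exts-subT : ∀ τ σ m → subT (exts τ) (exts σ m) ≡ exts (subT τ ∘ σ) m
exts-subT τ σ zero    = refl
exts-subT τ σ (suc m) = trans (subT-renT (exts τ) suc (σ m)) (sym (renT-subT suc τ (σ m)))

mutual
  subT-subT : ∀ τ σ t → subT τ (subT σ t) ≡ subT (subT τ ∘ σ) t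
  subT-subT τ σ (var n)    = refl
  subT-subT τ σ (fun f ts) = cong (fun f) (subTs-subTs τ σ ts)
  subT-subT τ σ (eps A)    = cong eps (subF-subF-ext τ σ A)

  subTs-subTs : ∀ τ σ ts → subTs τ (subTs σ ts) ≡ subTs (subT τ ∘ σ) ts
  subTs-subTs τ σ []       = refl
  subTs-subTs τ σ (t ∷ ts) = cong₂ _∷_ (subT-subT τ σ t) (subTs-subTs τ σ ts)

  subF-subF : ∀ τ σ A → subF τ (subF σ A) ≡ subF (subT τ ∘ σ) A
  subF-subF τ σ (fvar X)    = refl
  subF-subF τ σ (pred p ts) = cong (pred p) (subTs-subTs τ σ ts)
  subF-subF τ σ top         = refl
  subF-subF τ σ bot         = refl
  subF-subF τ σ (neg A)     = cong neg (subF-subF τ σ A)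
  subF-subF τ σ (bin o A B) = cong₂ (bin o) (subF-subF τ σ A) (subF-subF τ σ B)
  subF-subF τ σ (quant Q A) = cong (quant Q) (subF-subF-ext τ σ A)

  subF-subF-ext : ∀ τ σ A → subF (exts τ) (subF (exts σ) A) ≡ subF (exts (subT τ ∘ σ)) A
  subF-subF-ext τ σ A = trans (subF-subF (exts τ) (exts σ) A) (subF-cong (exts-subT τ σ) A)

mutual
  subT-id : ∀ t → subT var t ≡ t
  subT-id (var n)    = refl
  subT-id (fun f ts) = cong (fun f) (subTs-id ts)
  subT-id (eps A)    = cong eps (subF-id-ext A)

  subTs-id : ∀ ts → subTs var ts ≡ ts
  subTs-id []       = refl
  subTs-id (t ∷ ts) = cong₂ _∷_ (subT-id t) (subTs-id ts)

  subF-id : ∀ A → subF var A ≡ A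
  subF-id (fvar X)    = refl
  subF-id (pred p ts) = cong (pred p) (subTs-id ts)
  subF-id top         = refl
  subF-id bot         = refl
  subF-id (neg A)     = cong neg (subF-id A)
  subF-id (bin o A B) = cong₂ (bin o) (subF-id A) (subF-id B)
  subF-id (quant Q A) = cong (quant Q) (subF-id-ext A)

  subF-id-ext : ∀ A → subF (exts var) A ≡ A
  subF-id-ext A = trans (subF-cong exts-var A) (subF-id A)
    where exts-var : ∀ m → exts var m ≡ var m
          exts-var zero    = refl
          exts-var (suc m) = refl

negQ-subF : ∀ Q σ A → subF σ (negQ Q A) ≡ negQ Q (subF σ A)
negQ-subF ex  σ A = refl
negQ-subF all σ A = refl

subF-contract : ∀ Q σ A → subF σ (contract Q A) ≡ contract Q (subF (exts σ) A)
subF-contract Q σ A = begin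
  subF σ (A [ e ])                        ≡⟨ subF-subF σ (sub0σ e) A ⟩
  subF (subT σ ∘ sub0σ e) A               ≡⟨ subF-cong agree A ⟩
  subF (subT (sub0σ e') ∘ exts σ) A       ≡⟨ subF-subF (sub0σ e') (exts σ) A ⟨
  subF (exts σ) A [ e' ]                  ∎
  where
  e  = eps (negQ Q A)
  e' = eps (negQ Q (subF (exts σ) A))
  agree : ∀ m → subT σ (sub0σ e m) ≡ subT (sub0σ e') (exts σ m)
  agree zero    = cong eps (negQ-subF Q (exts σ) A)
  agree (suc m) = sym (trans (subT-renT (sub0σ e') suc (σ m)) (subT-id (σ m)))

mutual
  isFreeT-renT : ∀ ρ {n n'} → (∀ m → (n' ≡ᵇ ρ m) ≡ (n ≡ᵇ m)) →
                 ∀ t → isFreeT n' (renT ρ t) ≡ isFreeT n t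
  isFreeT-renT ρ h (var m)    = h m
  isFreeT-renT ρ h (fun f ts) = isFreeTs-renTs ρ h ts
  isFreeT-renT ρ h (eps A)    = isFreeF-renF (ext ρ) (ext-preserves h) A

  isFreeTs-renTs : ∀ ρ {n n'} → (∀ m → (n' ≡ᵇ ρ m) ≡ (n ≡ᵇ m)) →
                   ∀ ts → isFreeTs n' (renTs ρ ts) ≡ isFreeTs n ts
  isFreeTs-renTs ρ h []       = refl
  isFreeTs-renTs ρ h (t ∷ ts) = cong₂ _∨_ (isFreeT-renT ρ h t) (isFreeTs-renTs ρ h ts)

  isFreeF-renF : ∀ ρ {n n'} → (∀ m → (n' ≡ᵇ ρ m) ≡ (n ≡ᵇ m)) →
                 ∀ A → isFreeF n' (renF ρ A) ≡ isFreeF n A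
  isFreeF-renF ρ h (fvar X)    = refl
  isFreeF-renF ρ h (pred p ts) = isFreeTs-renTs ρ h ts
  isFreeF-renF ρ h top         = refl
  isFreeF-renF ρ h bot         = refl
  isFreeF-renF ρ h (neg A)     = isFreeF-renF ρ h A
  isFreeF-renF ρ h (bin o A B) = cong₂ _∨_ (isFreeF-renF ρ h A) (isFreeF-renF ρ h B)
  isFreeF-renF ρ h (quant Q A) = isFreeF-renF (ext ρ) (ext-preserves h) A

  ext-preserves : ∀ {ρ n n'} → (∀ m → (n' ≡ᵇ ρ m) ≡ (n ≡ᵇ m)) →
                  ∀ m → (suc n' ≡ᵇ ext ρ m) ≡ (suc n ≡ᵇ m)
  ext-preserves h zero    = refl
  ext-preserves h (suc m) = h m

isFreeT-weaken : ∀ n t → isFreeT (suc n) (renT suc t) ≡ isFreeT n t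
isFreeT-weaken n = isFreeT-renT suc (λ _ → refl)

mutual
  isFreeT-renT-∉ : ∀ ρ {n} → (∀ m → (n ≡ᵇ ρ m) ≡ false) → ∀ t → isFreeT n (renT ρ t) ≡ false
  isFreeT-renT-∉ ρ h (var m)    = h m
  isFreeT-renT-∉ ρ h (fun f ts) = isFreeTs-renTs-∉ ρ h ts
  isFreeT-renT-∉ ρ h (eps A)    = isFreeF-renF-∉ (ext ρ) (ext-∉ h) A

  isFreeTs-renTs-∉ : ∀ ρ {n} → (∀ m → (n ≡ᵇ ρ m) ≡ false) → ∀ ts → isFreeTs n (renTs ρ ts) ≡ false
  isFreeTs-renTs-∉ ρ h []       = refl
  isFreeTs-renTs-∉ ρ h (t ∷ ts) = cong₂ _∨_ (isFreeT-renT-∉ ρ h t) (isFreeTs-renTs-∉ ρ h ts)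

  isFreeF-renF-∉ : ∀ ρ {n} → (∀ m → (n ≡ᵇ ρ m) ≡ false) → ∀ A → isFreeF n (renF ρ A) ≡ false
  isFreeF-renF-∉ ρ h (fvar X)    = refl
  isFreeF-renF-∉ ρ h (pred p ts) = isFreeTs-renTs-∉ ρ h ts
  isFreeF-renF-∉ ρ h top         = refl
  isFreeF-renF-∉ ρ h bot         = refl
  isFreeF-renF-∉ ρ h (neg A)     = isFreeF-renF-∉ ρ h A
  isFreeF-renF-∉ ρ h (bin o A B) = cong₂ _∨_ (isFreeF-renF-∉ ρ h A) (isFreeF-renF-∉ ρ h B)
  isFreeF-renF-∉ ρ h (quant Q A) = isFreeF-renF-∉ (ext ρ) (ext-∉ h) A

  ext-∉ : ∀ {ρ n} → (∀ m → (n ≡ᵇ ρ m) ≡ false) → ∀ m → (suc n ≡ᵇ ext ρ m) ≡ false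
  ext-∉ h zero    = refl
  ext-∉ h (suc m) = h m

exts-preserves : ∀ {σ n} → (∀ m → isFreeT n (σ m) ≡ (n ≡ᵇ m)) →
                 ∀ m → isFreeT (suc n) (exts σ m) ≡ (suc n ≡ᵇ m)
exts-preserves         h zero    = refl
exts-preserves {σ} {n} h (suc m) = trans (isFreeT-weaken n (σ m)) (h m)

mutual
  isFreeT-subT : ∀ σ {n} → (∀ m → isFreeT n (σ m) ≡ (n ≡ᵇ m)) →
                 ∀ t → isFreeT n (subT σ t) ≡ isFreeT n t
  isFreeT-subT σ h (var m)    = h m
  isFreeT-subT σ h (fun f ts) = isFreeTs-subTs σ h ts
  isFreeT-subT σ h (eps A)    = isFreeF-subF (exts σ) (exts-preserves h) A

  isFreeTs-subTs : ∀ σ {n} → (∀ m → isFreeT n (σ m) ≡ (n ≡ᵇ m)) →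
                   ∀ ts → isFreeTs n (subTs σ ts) ≡ isFreeTs n ts
  isFreeTs-subTs σ h []       = refl
  isFreeTs-subTs σ h (t ∷ ts) = cong₂ _∨_ (isFreeT-subT σ h t) (isFreeTs-subTs σ h ts)

  isFreeF-subF : ∀ σ {n} → (∀ m → isFreeT n (σ m) ≡ (n ≡ᵇ m)) →
                 ∀ A → isFreeF n (subF σ A) ≡ isFreeF n A
  isFreeF-subF σ h (fvar X)    = refl
  isFreeF-subF σ h (pred p ts) = isFreeTs-subTs σ h ts
  isFreeF-subF σ h top         = refl
  isFreeF-subF σ h bot         = refl
  isFreeF-subF σ h (neg A)     = isFreeF-subF σ h A
  isFreeF-subF σ h (bin o A B) = cong₂ _∨_ (isFreeF-subF σ h A) (isFreeF-subF σ h B)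
  isFreeF-subF σ h (quant Q A) = isFreeF-subF (exts σ) (exts-preserves h) A

redexKind-subF-exts : ∀ σ A → redexKind (subF (exts σ) A) ≡ redexKind A
redexKind-subF-exts σ A = isFreeF-subF (exts σ) fixes-zero A
  where
  fixes-zero : ∀ m → isFreeT zero (exts σ m) ≡ (zero ≡ᵇ m)
  fixes-zero zero    = refl
  fixes-zero (suc m) = isFreeT-renT-∉ suc (λ _ → refl) (σ m)

mutual
  subT-keeps-free : ∀ σ {m n} t → T (isFreeT m t) → T (isFreeT n (σ m)) → T (isFreeT n (subT σ t))
  subT-keeps-free σ {m} {n} (var j) p q = subst (λ j → T (isFreeT n (σ j))) (≡ᵇ⇒≡ m j p) q
  subT-keeps-free σ (fun f ts) p q = subTs-keeps-free σ ts p q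
  subT-keeps-free σ {m} {n} (eps A) p q =
    subF-keeps-free (exts σ) A p (subst T (sym (isFreeT-weaken n (σ m))) q)

  subTs-keeps-free : ∀ σ {m n} ts → T (isFreeTs m ts) → T (isFreeT n (σ m)) → T (isFreeTs n (subTs σ ts))
  subTs-keeps-free σ (t ∷ ts) p q with to T-∨ p
  ... | inj₁ p' = from T-∨ (inj₁ (subT-keeps-free σ t p' q))
  ... | inj₂ p' = from T-∨ (inj₂ (subTs-keeps-free σ ts p' q))

  subF-keeps-free : ∀ σ {m n} A → T (isFreeF m A) → T (isFreeT n (σ m)) → T (isFreeF n (subF σ A))
  subF-keeps-free σ (pred p ts) r q = subTs-keeps-free σ ts r q
  subF-keeps-free σ (neg A)     p q = subF-keeps-free σ A p q
  subF-keeps-free σ (bin o A B) p q with to T-∨ p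
  ... | inj₁ p' = from T-∨ (inj₁ (subF-keeps-free σ A p' q))
  ... | inj₂ p' = from T-∨ (inj₂ (subF-keeps-free σ B p' q))
  subF-keeps-free σ {m} {n} (quant Q A) p q =
    subF-keeps-free (exts σ) A p (subst T (sym (isFreeT-weaken n (σ m))) q)

redex-subF : ∀ Q σ A → subF σ (quant Q A) ⟶[ redexKind A ] subF σ (contract Q A)
redex-subF Q σ A =
  subst₂ (λ k C → subF σ (quant Q A) ⟶[ k ] C)
         (redexKind-subF-exts σ A) (sym (subF-contract Q σ A)) redex

mutual
  ⟶T-subT : ∀ {t t' k} σ → t ⟶T[ k ] t' → subT σ t ⟶T[ k ] subT σ t'
  ⟶T-subT σ (funS s) = funS (⟶Ts-subTs σ s)
  ⟶T-subT σ (epsS s) = epsS (⟶-subF (exts σ) s)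

  ⟶Ts-subTs : ∀ {ts ts' k} σ → ts ⟶Ts[ k ] ts' → subTs σ ts ⟶Ts[ k ] subTs σ ts'
  ⟶Ts-subTs σ (hereS s)  = hereS (⟶T-subT σ s)
  ⟶Ts-subTs σ (thereS s) = thereS (⟶Ts-subTs σ s)

  ⟶-subF : ∀ {A A' k} σ → A ⟶[ k ] A' → subF σ A ⟶[ k ] subF σ A'
  ⟶-subF σ (redex {Q} {A}) = redex-subF Q σ A
  ⟶-subF σ (predS s)        = predS (⟶Ts-subTs σ s)
  ⟶-subF σ (negS s)         = negS (⟶-subF σ s)
  ⟶-subF σ (binL s)         = binL (⟶-subF σ s)
  ⟶-subF σ (binR s)         = binR (⟶-subF σ s)
  ⟶-subF σ (quantS s)       = quantS (⟶-subF (exts σ) s)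

negQ-⟶ : ∀ Q {A A' k} → A ⟶[ k ] A' → negQ Q A ⟶[ k ] negQ Q A'
negQ-⟶ ex  s = s
negQ-⟶ all s = negS s

-- The contractum of Q x. B keeps every free variable of B other than x,
-- since x is replaced by a term rather than erased.

mutual
  ⟶T-keeps-free : ∀ {t t' k} n → t ⟶T[ k ] t' → T (isFreeT n t) → T (isFreeT n t')
  ⟶T-keeps-free n (funS s) p = ⟶Ts-keeps-free n s p
  ⟶T-keeps-free n (epsS s) p = ⟶-keeps-free (suc n) s p

  ⟶Ts-keeps-free : ∀ {ts ts' k} n → ts ⟶Ts[ k ] ts' → T (isFreeTs n ts) → T (isFreeTs n ts')
  ⟶Ts-keeps-free n (hereS s) p with to T-∨ p
  ... | inj₁ p' = from T-∨ (inj₁ (⟶T-keeps-free n s p'))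
  ... | inj₂ p' = from T-∨ (inj₂ p')
  ⟶Ts-keeps-free n (thereS s) p with to T-∨ p
  ... | inj₁ p' = from T-∨ (inj₁ p')
  ... | inj₂ p' = from T-∨ (inj₂ (⟶Ts-keeps-free n s p'))

  ⟶-keeps-free : ∀ {A A' k} n → A ⟶[ k ] A' → T (isFreeF n A) → T (isFreeF n A')
  ⟶-keeps-free n (redex {A = B}) p = subF-keeps-free _ B p (≡⇒≡ᵇ n n refl)
  ⟶-keeps-free n (predS s)  p = ⟶Ts-keeps-free n s p
  ⟶-keeps-free n (negS s)   p = ⟶-keeps-free n s p
  ⟶-keeps-free n (binL s)   p with to T-∨ p
  ... | inj₁ p' = from T-∨ (inj₁ (⟶-keeps-free n s p'))
  ... | inj₂ p' = from T-∨ (inj₂ p')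
  ⟶-keeps-free n (binR s)   p with to T-∨ p
  ... | inj₁ p' = from T-∨ (inj₁ p')
  ... | inj₂ p' = from T-∨ (inj₂ (⟶-keeps-free n s p'))
  ⟶-keeps-free n (quantS s) p = ⟶-keeps-free (suc n) s p

mutual
  ⇉T-refl : ∀ {m} t → t ⇉T[ m ] t
  ⇉T-refl (var n)    = varP
  ⇉T-refl (fun f ts) = funP (⇉Ts-refl ts)
  ⇉T-refl (eps A)    = epsP (⇉-refl A)

  ⇉Ts-refl : ∀ {m} ts → ts ⇉Ts[ m ] ts
  ⇉Ts-refl []       = []P
  ⇉Ts-refl (t ∷ ts) = ⇉T-refl t ∷P ⇉Ts-refl ts

  ⇉-refl : ∀ {m} A → A ⇉[ m ] A
  ⇉-refl (fvar X)    = fvarP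
  ⇉-refl (pred p ts) = predP (⇉Ts-refl ts)
  ⇉-refl top         = topP
  ⇉-refl bot         = botP
  ⇉-refl (neg A)     = negP (⇉-refl A)
  ⇉-refl (bin o A B) = binP (⇉-refl A) (⇉-refl B)
  ⇉-refl (quant Q A) = quantP (⇉-refl A)

mutual
  ⟶T⇒⇉T : ∀ {t t' k m} → Allowed m k → t ⟶T[ k ] t' → t ⇉T[ m ] t'
  ⟶T⇒⇉T a (funS s) = funP (⟶Ts⇒⇉Ts a s)
  ⟶T⇒⇉T a (epsS s) = epsP (⟶⇒⇉ a s)

  ⟶Ts⇒⇉Ts : ∀ {ts ts' k m} → Allowed m k → ts ⟶Ts[ k ] ts' → ts ⇉Ts[ m ] ts'
  ⟶Ts⇒⇉Ts a (hereS {ts = ts} s) = ⟶T⇒⇉T a s ∷P ⇉Ts-refl ts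
  ⟶Ts⇒⇉Ts a (thereS {t = t} s)  = ⇉T-refl t ∷P ⟶Ts⇒⇉Ts a s

  ⟶⇒⇉ : ∀ {A A' k m} → Allowed m k → A ⟶[ k ] A' → A ⇉[ m ] A'
  ⟶⇒⇉ a redex            = redexP a
  ⟶⇒⇉ a (predS s)        = predP (⟶Ts⇒⇉Ts a s)
  ⟶⇒⇉ a (negS s)         = negP (⟶⇒⇉ a s)
  ⟶⇒⇉ a (binL {B = B} s) = binP (⟶⇒⇉ a s) (⇉-refl B)
  ⟶⇒⇉ a (binR {A = A} s) = binP (⇉-refl A) (⟶⇒⇉ a s)
  ⟶⇒⇉ a (quantS s)       = quantP (⟶⇒⇉ a s)

mutual
  ⇉T-subT : ∀ {t t' m} σ → t ⇉T[ m ] t' → subT σ t ⇉T[ m ] subT σ t'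
  ⇉T-subT σ (varP {n}) = ⇉T-refl (σ n)
  ⇉T-subT σ (funP p)   = funP (⇉Ts-subTs σ p)
  ⇉T-subT σ (epsP p)   = epsP (⇉-subF (exts σ) p)

  ⇉Ts-subTs : ∀ {ts ts' m} σ → ts ⇉Ts[ m ] ts' → subTs σ ts ⇉Ts[ m ] subTs σ ts'
  ⇉Ts-subTs σ []P       = []P
  ⇉Ts-subTs σ (p ∷P ps) = ⇉T-subT σ p ∷P ⇉Ts-subTs σ ps

  ⇉-subF : ∀ {A A' m} σ → A ⇉[ m ] A' → subF σ A ⇉[ m ] subF σ A'
  ⇉-subF {m = m} σ (redexP {Q} {A} a) =
    subst (subF σ (quant Q A) ⇉[ m ]_) (sym (subF-contract Q σ A))
          (redexP (subst (Allowed m) (sym (redexKind-subF-exts σ A)) a))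
  ⇉-subF σ fvarP      = fvarP
  ⇉-subF σ (predP p)  = predP (⇉Ts-subTs σ p)
  ⇉-subF σ topP       = topP
  ⇉-subF σ botP       = botP
  ⇉-subF σ (negP p)   = negP (⇉-subF σ p)
  ⇉-subF σ (binP p q) = binP (⇉-subF σ p) (⇉-subF σ q)
  ⇉-subF σ (quantP p) = quantP (⇉-subF (exts σ) p)

⇉T-renT : ∀ {t t' m} ρ → t ⇉T[ m ] t' → renT ρ t ⇉T[ m ] renT ρ t'
⇉T-renT {t} {t'} {m} ρ p =
  subst₂ (_⇉T[ m ]_) (sym (renT-as-subT ρ t)) (sym (renT-as-subT ρ t')) (⇉T-subT (var ∘ ρ) p)

mutual
  subT-⇉ : ∀ {σ τ m} → (∀ j → σ j ⇉T[ m ] τ j) → ∀ t → subT σ t ⇉T[ m ] subT τ t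
  subT-⇉ h (var n)    = h n
  subT-⇉ h (fun f ts) = funP (subTs-⇉ h ts)
  subT-⇉ h (eps A)    = epsP (subF-⇉ (exts-⇉ h) A)

  subTs-⇉ : ∀ {σ τ m} → (∀ j → σ j ⇉T[ m ] τ j) → ∀ ts → subTs σ ts ⇉Ts[ m ] subTs τ ts
  subTs-⇉ h []       = []P
  subTs-⇉ h (t ∷ ts) = subT-⇉ h t ∷P subTs-⇉ h ts

  subF-⇉ : ∀ {σ τ m} → (∀ j → σ j ⇉T[ m ] τ j) → ∀ A → subF σ A ⇉[ m ] subF τ A
  subF-⇉ h (fvar X)    = fvarP
  subF-⇉ h (pred p ts) = predP (subTs-⇉ h ts)
  subF-⇉ h top         = topP
  subF-⇉ h bot         = botP
  subF-⇉ h (neg A)     = negP (subF-⇉ h A)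
  subF-⇉ h (bin o A B) = binP (subF-⇉ h A) (subF-⇉ h B)
  subF-⇉ h (quant Q A) = quantP (subF-⇉ (exts-⇉ h) A)

  exts-⇉ : ∀ {σ τ m} → (∀ j → σ j ⇉T[ m ] τ j) → ∀ j → exts σ j ⇉T[ m ] exts τ j
  exts-⇉ h zero    = varP
  exts-⇉ h (suc j) = ⇉T-renT suc (h j)

[]-⇉ : ∀ {t t' m} A → t ⇉T[ m ] t' → A [ t ] ⇉[ m ] A [ t' ]
[]-⇉ {t} {t'} {m} A p = subF-⇉ agree A
  where
  agree : ∀ j → sub0σ t j ⇉T[ m ] sub0σ t' j
  agree zero    = p
  agree (suc j) = varP

lemma3p3 : (Q₁ : Quant) (A A' : Form) (k : Bool) → A ⟶[ k ] A' →
    Σ Form λ F₃ → Σ Form λ F₄ →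
      ((quant Q₁ A' ⟶ F₄) × (F₃ ⟶ F₄) × (contract Q₁ A ⇉[ anyR ] F₃))
      × (k ≡ true → (F₃ ⟶[ true ] F₄) × (contract Q₁ A ⇉[ nonvacR ] F₃))
      × (redexKind A ≡ true → quant Q₁ A' ⟶[ true ] F₄)
      × (redexKind A ≡ false → F₃ ≡ contract Q₁ A)
lemma3p3 Q A A' k s =
  A [ e' ] , contract Q A' ,
  ((redexKind A' , redex) , (k , F₃⟶F₄) , F₂⇉F₃ tt) ,
  (λ { refl → F₃⟶F₄ , F₂⇉F₃ refl }) ,
  (λ nonvac → subst (λ b → quant Q A' ⟶[ b ] contract Q A') (kind-kept nonvac) redex) ,
  (λ vac → []-vacuous A e' e vac)
  where
  e  = eps (negQ Q A)
  e' = eps (negQ Q A')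
  F₃⟶F₄ : A [ e' ] ⟶[ k ] A' [ e' ]
  F₃⟶F₄ = ⟶-subF (sub0σ e') s
  F₂⇉F₃ : ∀ {m} → Allowed m k → contract Q A ⇉[ m ] A [ e' ]
  F₂⇉F₃ a = []-⇉ A (epsP (⟶⇒⇉ a (negQ-⟶ Q s)))
  kind-kept : redexKind A ≡ true → redexKind A' ≡ true
  kind-kept = to T-≡ ∘ ⟶-keeps-free zero s ∘ from T-≡
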